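{- Let $D$ be an $n\times n$ invertible complex matrix, let $\lambda$ be a nonzero complex number, let $\alpha,\beta$ be $n\times 1$ complex column vectors, and let $L=-D^{ -1}+\frac{1}{\lambda}\beta\alpha^T$. Let $\mathbf{j}$ be the $n\times 1$ all-ones column vector. Then $L$ is a Laplacian-like matrix (i.e. $L\mathbf{j}=\mathbf{0}$ and $\mathbf{j}^TL=\mathbf{0}$) if one of the following conditions holds: (1) $\alpha^TD=\lambda\mathbf{j}^T$, $\mathbf{j}^T\beta=1$ and $L\mathbf{j}=\mathbf{0}$; (2) $D\beta=\lambda\mathbf{j}$, $\alpha^T\mathbf{j}=1$ and $\mathbf{j}^TL=\mathbf{0}$; (3) $\alpha^TD=\lambda\mathbf{j}^T$, $D\beta=\lambda\mathbf{j}$ and $\mathbf{j}^T\beta=\alpha^T\mathbf{j}=1$.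
   Context: $M^T$ denotes transpose; $\mathbf{0}$ denotes a zero matrix/vector of appropriate size. A square matrix $L$ is called Laplacian-like if $L\mathbf{j}=\mathbf{0}$ and $\mathbf{j}^TL=\mathbf{0}$. -}

module Defs where

open import Level using (_⊔_)
open import Data.Nat using (ℕ; zero; suc)
open import Data.Fin using (Fin; zero; suc)
open import Data.Product using (Σ; _×_)
open import Relation.Nullary using (¬_)
open import Algebra.Bundles using (CommutativeRing)

record Field (c ℓ : Level.Level) : Set (Level.suc (c ⊔ ℓ)) where
  field
    commutativeRing : CommutativeRing c ℓ
  open CommutativeRing commutativeRing public
  field
    nontrivial : ¬ (1# ≈ 0#)
    inverse    : ∀ x → ¬ (x ≈ 0#) → Σ Carrier (λ y → x * y ≈ 1#)

module MatrixOps {c ℓ} (R : CommutativeRing c ℓ) where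
  open CommutativeRing R using (Carrier; _≈_; _+_; _*_; -_; 0#; 1#)

  Matrix : ℕ → ℕ → Set c
  Matrix m n = Fin m → Fin n → Carrier

  ∑ : ∀ {n} → (Fin n → Carrier) → Carrier
  ∑ {zero}  f = 0#
  ∑ {suc n} f = f zero + ∑ (λ i → f (suc i))

  _·_ : ∀ {m k n} → Matrix m k → Matrix k n → Matrix m n
  (A · B) i j = ∑ (λ t → A i t * B t j)

  _⊕_ : ∀ {m n} → Matrix m n → Matrix m n → Matrix m n
  (A ⊕ B) i j = A i j + B i j

  ⊖_ : ∀ {m n} → Matrix m n → Matrix m n
  (⊖ A) i j = - A i j

  _⊙_ : ∀ {m n} → Carrier → Matrix m n → Matrix m n
  (a ⊙ A) i j = a * A i j

  _ᵀ : ∀ {m n} → Matrix m n → Matrix n m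
  (A ᵀ) i j = A j i

  𝟎 : ∀ {m n} → Matrix m n
  𝟎 i j = 0#

  I : ∀ {n} → Matrix n n
  I zero    zero    = 1#
  I zero    (suc j) = 0#
  I (suc i) zero    = 0#
  I (suc i) (suc j) = I i j

  𝐣 : ∀ {n} → Matrix n 1
  𝐣 i k = 1#

  _≈ᴹ_ : ∀ {m n} → Matrix m n → Matrix m n → Set ℓ
  A ≈ᴹ B = ∀ i j → A i j ≈ B i j

  LaplacianLike : ∀ {n} → Matrix n n → Set ℓ
  LaplacianLike L = ((L · 𝐣) ≈ᴹ 𝟎) × (((𝐣 ᵀ) · L) ≈ᴹ 𝟎)

-- From αᵀD = λ𝐣ᵀ and DD⁻¹ = I we get αᵀ = λ𝐣ᵀD⁻¹, so if moreover 𝐣ᵀβ = 1 the rank-one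
-- term of L contributes 𝐣ᵀ(λ⁻¹βαᵀ) = λ⁻¹αᵀ = 𝐣ᵀD⁻¹, which cancels 𝐣ᵀ(−D⁻¹): 𝐣ᵀL = 0.
-- Transposing L exchanges α with β and D with Dᵀ, so Dβ = λ𝐣 and αᵀ𝐣 = 1 give L𝐣 = 0.
-- Each of the three conditions supplies whichever of these two arguments is not already
-- assumed.

module Submission where

open import Defs
open import Level using (Level)
open import Data.Nat using (ℕ; zero; suc)
open import Data.Fin using (Fin; zero; suc)
open import Data.Product using (_×_; _,_)
open import Data.Sum using (_⊎_; inj₁; inj₂)
open import Function using (_∘_)
open import Relation.Nullary using (¬_)
open import Relation.Binary.Bundles using (Setoid)
open import Relation.Binary.PropositionalEquality as ≡ using (_≡_)
open import Algebra.Bundles using (CommutativeRing)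
import Algebra.Properties.Ring as RingProperties
import Algebra.Properties.CommutativeSemigroup as CommutativeSemigroupProperties
import Algebra.Properties.Semiring.Sum as Sum
import Data.Vec.Functional.Relation.Binary.Pointwise.Properties as Pointwise
import Relation.Binary.Reasoning.Setoid as SetoidReasoning

module SumProperties {c ℓ} (R : CommutativeRing c ℓ) where
  open CommutativeRing R hiding (zero)
  open MatrixOps R using (∑; I)
  open Sum semiring
    using (sum; sum-cong-≗; sum-cong-≋; sum-replicate-zero; *-distribˡ-sum; *-distribʳ-sum)
    renaming (∑-distrib-+ to sum-distrib-+; ∑-comm to sum-comm)
  open SetoidReasoning setoid

  ∑≡sum : ∀ {n} (f : Fin n → Carrier) → ∑ f ≡ sum f
  ∑≡sum {zero}  f = ≡.refl
  ∑≡sum {suc n} f = ≡.cong (f zero +_) (∑≡sum (f ∘ suc))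

  ∑-cong : ∀ {n} {f g : Fin n → Carrier} → (∀ i → f i ≈ g i) → ∑ f ≈ ∑ g
  ∑-cong {f = f} {g} f≈g = begin
    ∑ f   ≡⟨ ∑≡sum f ⟩
    sum f ≈⟨ sum-cong-≋ f≈g ⟩
    sum g ≡⟨ ∑≡sum g ⟨
    ∑ g   ∎

  ∑-distribˡ-* : ∀ {n} x (f : Fin n → Carrier) → x * ∑ f ≈ ∑ (λ i → x * f i)
  ∑-distribˡ-* x f = begin
    x * ∑ f                ≡⟨ ≡.cong (x *_) (∑≡sum f) ⟩
    x * sum f              ≈⟨ *-distribˡ-sum x f ⟩
    sum (λ i → x * f i)    ≡⟨ ∑≡sum (λ i → x * f i) ⟨
    ∑ (λ i → x * f i)      ∎

  ∑-distribʳ-* : ∀ {n} x (f : Fin n → Carrier) → ∑ f * x ≈ ∑ (λ i → f i * x)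
  ∑-distribʳ-* x f = begin
    ∑ f * x                ≡⟨ ≡.cong (_* x) (∑≡sum f) ⟩
    sum f * x              ≈⟨ *-distribʳ-sum x f ⟩
    sum (λ i → f i * x)    ≡⟨ ∑≡sum (λ i → f i * x) ⟨
    ∑ (λ i → f i * x)      ∎

  ∑-distrib-+ : ∀ {n} (f g : Fin n → Carrier) → ∑ (λ i → f i + g i) ≈ ∑ f + ∑ g
  ∑-distrib-+ f g = begin
    ∑ (λ i → f i + g i)    ≡⟨ ∑≡sum (λ i → f i + g i) ⟩
    sum (λ i → f i + g i)  ≈⟨ sum-distrib-+ f g ⟩
    sum f + sum g          ≡⟨ ≡.cong₂ _+_ (∑≡sum f) (∑≡sum g) ⟨
    ∑ f + ∑ g              ∎

  ∑-comm : ∀ {m n} (f : Fin m → Fin n → Carrier) →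
           ∑ (λ i → ∑ (f i)) ≈ ∑ (λ j → ∑ (λ i → f i j))
  ∑-comm f = begin
    ∑ (λ i → ∑ (f i))                ≡⟨ ∑∑≡sum∑ f ⟩
    sum (λ i → sum (f i))            ≈⟨ sum-comm f ⟩
    sum (λ j → sum (λ i → f i j))    ≡⟨ ∑∑≡sum∑ (λ j i → f i j) ⟨
    ∑ (λ j → ∑ (λ i → f i j))        ∎
    where
    ∑∑≡sum∑ : ∀ {m n} (g : Fin m → Fin n → Carrier) → ∑ (λ i → ∑ (g i)) ≡ sum (λ i → sum (g i))
    ∑∑≡sum∑ g = ≡.trans (∑≡sum (λ i → ∑ (g i))) (sum-cong-≗ (∑≡sum ∘ g))

  ∑-zero : ∀ n → ∑ {n} (λ _ → 0#) ≈ 0#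
  ∑-zero n = trans (reflexive (∑≡sum {n} (λ _ → 0#))) (sum-replicate-zero n)

  I-symmetric : ∀ {n} (i j : Fin n) → I i j ≡ I j i
  I-symmetric zero    zero    = ≡.refl
  I-symmetric zero    (suc j) = ≡.refl
  I-symmetric (suc i) zero    = ≡.refl
  I-symmetric (suc i) (suc j) = I-symmetric i j

  ∑-Iˡ : ∀ {n} (f : Fin n → Carrier) i → ∑ (λ t → I i t * f t) ≈ f i
  ∑-Iˡ {suc n} f zero = begin
    1# * f zero + ∑ (λ t → 0# * f (suc t))
      ≈⟨ +-cong (*-identityˡ (f zero)) (∑-cong (λ t → zeroˡ (f (suc t)))) ⟩
    f zero + ∑ {n} (λ _ → 0#)               ≈⟨ +-congˡ (∑-zero n) ⟩
    f zero + 0#                             ≈⟨ +-identityʳ (f zero) ⟩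
    f zero                                  ∎
  ∑-Iˡ {suc n} f (suc i) = begin
    0# * f zero + ∑ (λ t → I i t * f (suc t))  ≈⟨ +-cong (zeroˡ (f zero)) (∑-Iˡ (f ∘ suc) i) ⟩
    0# + f (suc i)                             ≈⟨ +-identityˡ (f (suc i)) ⟩
    f (suc i)                                  ∎

  ∑-Iʳ : ∀ {n} (f : Fin n → Carrier) j → ∑ (λ t → f t * I t j) ≈ f j
  ∑-Iʳ f j = trans (∑-cong f·I≈I·f) (∑-Iˡ f j)
    where
    f·I≈I·f : ∀ t → f t * I t j ≈ I j t * f t
    f·I≈I·f t = trans (*-comm (f t) (I t j)) (*-congʳ (reflexive (I-symmetric t j)))

module MatrixProperties {c ℓ} (R : CommutativeRing c ℓ) where
  open CommutativeRing R hiding (zero)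
  open MatrixOps R
  open SumProperties R
  open RingProperties ring using (-1*x≈-x)
  open CommutativeSemigroupProperties *-commutativeSemigroup using (x∙yz≈y∙xz)

  ≈ᴹ-setoid : ℕ → ℕ → Setoid c ℓ
  ≈ᴹ-setoid m n = Pointwise.setoid (Pointwise.setoid setoid n) m

  module ≈ᴹ-Reasoning {m n : ℕ} = SetoidReasoning (≈ᴹ-setoid m n)

  ·-cong : ∀ {m k n} {A A′ : Matrix m k} {B B′ : Matrix k n} →
           A ≈ᴹ A′ → B ≈ᴹ B′ → (A · B) ≈ᴹ (A′ · B′)
  ·-cong A≈A′ B≈B′ i j = ∑-cong (λ t → *-cong (A≈A′ i t) (B≈B′ t j))

  ·-congˡ : ∀ {m k n} (A : Matrix m k) {B B′ : Matrix k n} → B ≈ᴹ B′ → (A · B) ≈ᴹ (A · B′)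
  ·-congˡ A = ·-cong (λ _ _ → refl)

  ·-congʳ : ∀ {m k n} {A A′ : Matrix m k} (B : Matrix k n) → A ≈ᴹ A′ → (A · B) ≈ᴹ (A′ · B)
  ·-congʳ B A≈A′ = ·-cong A≈A′ (λ _ _ → refl)

  ·-assoc : ∀ {m k p n} (A : Matrix m k) (B : Matrix k p) (C : Matrix p n) →
            ((A · B) · C) ≈ᴹ (A · (B · C))
  ·-assoc A B C i j = begin
    ∑ (λ s → ∑ (λ t → A i t * B t s) * C s j)
      ≈⟨ ∑-cong (λ s → ∑-distribʳ-* (C s j) (λ t → A i t * B t s)) ⟩
    ∑ (λ s → ∑ (λ t → A i t * B t s * C s j))
      ≈⟨ ∑-comm (λ s t → A i t * B t s * C s j) ⟩
    ∑ (λ t → ∑ (λ s → A i t * B t s * C s j))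
      ≈⟨ ∑-cong (λ t → ∑-cong (λ s → *-assoc (A i t) (B t s) (C s j))) ⟩
    ∑ (λ t → ∑ (λ s → A i t * (B t s * C s j)))
      ≈⟨ ∑-cong (λ t → ∑-distribˡ-* (A i t) (λ s → B t s * C s j)) ⟨
    ∑ (λ t → A i t * ∑ (λ s → B t s * C s j))
      ∎
    where open SetoidReasoning setoid

  ·-identityˡ : ∀ {m n} (A : Matrix m n) → (I · A) ≈ᴹ A
  ·-identityˡ A i j = ∑-Iˡ (λ t → A t j) i

  ·-identityʳ : ∀ {m n} (A : Matrix m n) → (A · I) ≈ᴹ A
  ·-identityʳ A i j = ∑-Iʳ (A i) j

  ·-distribˡ-⊕ : ∀ {m k n} (A : Matrix m k) (B C : Matrix k n) →
                 (A · (B ⊕ C)) ≈ᴹ ((A · B) ⊕ (A · C))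
  ·-distribˡ-⊕ A B C i j =
    trans (∑-cong (λ t → distribˡ (A i t) (B t j) (C t j)))
          (∑-distrib-+ (λ t → A i t * B t j) (λ t → A i t * C t j))

  ·-⊙ʳ : ∀ {m k n} x (A : Matrix m k) (B : Matrix k n) → (A · (x ⊙ B)) ≈ᴹ (x ⊙ (A · B))
  ·-⊙ʳ x A B i j =
    trans (∑-cong (λ t → x∙yz≈y∙xz (A i t) x (B t j))) (sym (∑-distribˡ-* x (λ t → A i t * B t j)))

  ·-⊙ˡ : ∀ {m k n} x (A : Matrix m k) (B : Matrix k n) → ((x ⊙ A) · B) ≈ᴹ (x ⊙ (A · B))
  ·-⊙ˡ x A B i j =
    trans (∑-cong (λ t → *-assoc x (A i t) (B t j))) (sym (∑-distribˡ-* x (λ t → A i t * B t j)))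

  ⊖≈-1⊙ : ∀ {m n} (A : Matrix m n) → (⊖ A) ≈ᴹ ((- 1#) ⊙ A)
  ⊖≈-1⊙ A i j = sym (-1*x≈-x (A i j))

  ·-⊖ʳ : ∀ {m k n} (A : Matrix m k) (B : Matrix k n) → (A · (⊖ B)) ≈ᴹ (⊖ (A · B))
  ·-⊖ʳ A B = begin
    A · (⊖ B)           ≈⟨ ·-congˡ A (⊖≈-1⊙ B) ⟩
    A · ((- 1#) ⊙ B)    ≈⟨ ·-⊙ʳ (- 1#) A B ⟩
    (- 1#) ⊙ (A · B)    ≈⟨ ⊖≈-1⊙ (A · B) ⟨
    ⊖ (A · B)           ∎
    where open ≈ᴹ-Reasoning

  ⊕-cong : ∀ {m n} {A A′ B B′ : Matrix m n} → A ≈ᴹ A′ → B ≈ᴹ B′ → (A ⊕ B) ≈ᴹ (A′ ⊕ B′)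
  ⊕-cong A≈A′ B≈B′ i j = +-cong (A≈A′ i j) (B≈B′ i j)

  ⊕-congˡ : ∀ {m n} {A B B′ : Matrix m n} → B ≈ᴹ B′ → (A ⊕ B) ≈ᴹ (A ⊕ B′)
  ⊕-congˡ = ⊕-cong (λ _ _ → refl)

  ⊙-congˡ : ∀ {m n} x {A B : Matrix m n} → A ≈ᴹ B → (x ⊙ A) ≈ᴹ (x ⊙ B)
  ⊙-congˡ x A≈B i j = *-congˡ (A≈B i j)

  ⊖-inverseˡ : ∀ {m n} (A : Matrix m n) → ((⊖ A) ⊕ A) ≈ᴹ 𝟎
  ⊖-inverseˡ A i j = -‿inverseˡ (A i j)

  ⊙-inverse : ∀ {m n} {x x⁻¹} → x * x⁻¹ ≈ 1# → (A : Matrix m n) → (x⁻¹ ⊙ (x ⊙ A)) ≈ᴹ A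
  ⊙-inverse {x = x} {x⁻¹} x·x⁻¹≈1 A i j = begin
    x⁻¹ * (x * A i j)  ≈⟨ *-assoc x⁻¹ x (A i j) ⟨
    x⁻¹ * x * A i j    ≈⟨ *-congʳ (trans (*-comm x⁻¹ x) x·x⁻¹≈1) ⟩
    1# * A i j         ≈⟨ *-identityˡ (A i j) ⟩
    A i j              ∎
    where open SetoidReasoning setoid

  ᵀ-cong : ∀ {m n} {A B : Matrix m n} → A ≈ᴹ B → (A ᵀ) ≈ᴹ (B ᵀ)
  ᵀ-cong A≈B i j = A≈B j i

  ᵀ-anti-homo-· : ∀ {m k n} (A : Matrix m k) (B : Matrix k n) → ((A · B) ᵀ) ≈ᴹ ((B ᵀ) · (A ᵀ))
  ᵀ-anti-homo-· A B i j = ∑-cong (λ t → *-comm (A j t) (B t i))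

  Iᵀ≈I : ∀ {n} → (I {n} ᵀ) ≈ᴹ I
  Iᵀ≈I i j = reflexive (I-symmetric j i)

  A·B≈C⇒Bᵀ·Aᵀ≈Cᵀ : ∀ {m k n} (A : Matrix m k) (B : Matrix k n) {C : Matrix m n} →
                     (A · B) ≈ᴹ C → ((B ᵀ) · (A ᵀ)) ≈ᴹ (C ᵀ)
  A·B≈C⇒Bᵀ·Aᵀ≈Cᵀ A B AB≈C i j = trans (sym (ᵀ-anti-homo-· A B i j)) (AB≈C j i)

  A·B≈I⇒Bᵀ·Aᵀ≈I : ∀ {m n} (A : Matrix m n) (B : Matrix n m) → (A · B) ≈ᴹ I → ((B ᵀ) · (A ᵀ)) ≈ᴹ I
  A·B≈I⇒Bᵀ·Aᵀ≈I A B AB≈I i j = trans (A·B≈C⇒Bᵀ·Aᵀ≈Cᵀ A B AB≈I i j) (Iᵀ≈I i j)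

  A·D≈B⇒A≈B·D⁻¹ : ∀ {m n} {A B : Matrix m n} {D D⁻¹ : Matrix n n} →
                   (D · D⁻¹) ≈ᴹ I → (A · D) ≈ᴹ B → A ≈ᴹ (B · D⁻¹)
  A·D≈B⇒A≈B·D⁻¹ {A = A} {B} {D} {D⁻¹} D·D⁻¹≈I A·D≈B = begin
    A              ≈⟨ ·-identityʳ A ⟨
    A · I          ≈⟨ ·-congˡ A D·D⁻¹≈I ⟨
    A · (D · D⁻¹)  ≈⟨ ·-assoc A D D⁻¹ ⟨
    (A · D) · D⁻¹  ≈⟨ ·-congʳ D⁻¹ A·D≈B ⟩
    B · D⁻¹        ∎
    where open ≈ᴹ-Reasoning

module PerturbedInverse {c ℓ} (R : CommutativeRing c ℓ) where
  open CommutativeRing R hiding (zero)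
  open MatrixOps R
  open MatrixProperties R

  L : ∀ {n k} → Matrix n n → Carrier → Matrix n k → Matrix n k → Matrix n n
  L D⁻¹ x⁻¹ α β = (⊖ D⁻¹) ⊕ (x⁻¹ ⊙ (β · (α ᵀ)))

  Lᵀ≈L : ∀ {n k} (D⁻¹ : Matrix n n) x⁻¹ (α β : Matrix n k) → (L D⁻¹ x⁻¹ α β ᵀ) ≈ᴹ L (D⁻¹ ᵀ) x⁻¹ β α
  Lᵀ≈L D⁻¹ x⁻¹ α β i j = +-congˡ (*-congˡ (ᵀ-anti-homo-· β (α ᵀ) i j))

  uᵀL≈𝟎 : ∀ {n k} {D D⁻¹ : Matrix n n} {x x⁻¹} (u α β : Matrix n k) →
          (D · D⁻¹) ≈ᴹ I → x * x⁻¹ ≈ 1# →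
          ((α ᵀ) · D) ≈ᴹ (x ⊙ (u ᵀ)) → ((u ᵀ) · β) ≈ᴹ I →
          ((u ᵀ) · L D⁻¹ x⁻¹ α β) ≈ᴹ 𝟎
  uᵀL≈𝟎 {D⁻¹ = D⁻¹} {x} {x⁻¹} u α β D·D⁻¹≈I x·x⁻¹≈1 αᵀ·D≈x⊙uᵀ uᵀ·β≈I = begin
    uᵀ · ((⊖ D⁻¹) ⊕ (x⁻¹ ⊙ (β · αᵀ)))          ≈⟨ ·-distribˡ-⊕ uᵀ (⊖ D⁻¹) (x⁻¹ ⊙ (β · αᵀ)) ⟩
    (uᵀ · (⊖ D⁻¹)) ⊕ (uᵀ · (x⁻¹ ⊙ (β · αᵀ)))    ≈⟨ ⊕-cong (·-⊖ʳ uᵀ D⁻¹) (·-⊙ʳ x⁻¹ uᵀ (β · αᵀ)) ⟩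
    (⊖ (uᵀ · D⁻¹)) ⊕ (x⁻¹ ⊙ (uᵀ · (β · αᵀ)))    ≈⟨ ⊕-congˡ (⊙-congˡ x⁻¹ uᵀ·β·αᵀ≈x⊙uᵀ·D⁻¹) ⟩
    (⊖ (uᵀ · D⁻¹)) ⊕ (x⁻¹ ⊙ (x ⊙ (uᵀ · D⁻¹)))   ≈⟨ ⊕-congˡ (⊙-inverse x·x⁻¹≈1 (uᵀ · D⁻¹)) ⟩
    (⊖ (uᵀ · D⁻¹)) ⊕ (uᵀ · D⁻¹)                 ≈⟨ ⊖-inverseˡ (uᵀ · D⁻¹) ⟩
    𝟎                                           ∎
    where
    open ≈ᴹ-Reasoning
    uᵀ = u ᵀ
    αᵀ = α ᵀ
    uᵀ·β·αᵀ≈x⊙uᵀ·D⁻¹ : (uᵀ · (β · αᵀ)) ≈ᴹ (x ⊙ (uᵀ · D⁻¹))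
    uᵀ·β·αᵀ≈x⊙uᵀ·D⁻¹ = begin
      uᵀ · (β · αᵀ)    ≈⟨ ·-assoc uᵀ β αᵀ ⟨
      (uᵀ · β) · αᵀ    ≈⟨ ·-congʳ αᵀ uᵀ·β≈I ⟩
      I · αᵀ           ≈⟨ ·-identityˡ αᵀ ⟩
      αᵀ               ≈⟨ A·D≈B⇒A≈B·D⁻¹ D·D⁻¹≈I αᵀ·D≈x⊙uᵀ ⟩
      (x ⊙ uᵀ) · D⁻¹   ≈⟨ ·-⊙ˡ x uᵀ D⁻¹ ⟩
      x ⊙ (uᵀ · D⁻¹)   ∎

  Lu≈𝟎 : ∀ {n k} {D D⁻¹ : Matrix n n} {x x⁻¹} (u α β : Matrix n k) →
         (D⁻¹ · D) ≈ᴹ I → x * x⁻¹ ≈ 1# →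
         (D · β) ≈ᴹ (x ⊙ u) → ((α ᵀ) · u) ≈ᴹ I →
         (L D⁻¹ x⁻¹ α β · u) ≈ᴹ 𝟎
  Lu≈𝟎 {D = D} {D⁻¹} {x} {x⁻¹} u α β D⁻¹·D≈I x·x⁻¹≈1 D·β≈x⊙u αᵀ·u≈I = begin
    L D⁻¹ x⁻¹ α β · u                  ≈⟨ ᵀ-cong (ᵀ-anti-homo-· (L D⁻¹ x⁻¹ α β) u) ⟩
    ((u ᵀ) · (L D⁻¹ x⁻¹ α β ᵀ)) ᵀ      ≈⟨ ᵀ-cong (·-congˡ (u ᵀ) (Lᵀ≈L D⁻¹ x⁻¹ α β)) ⟩
    ((u ᵀ) · L (D⁻¹ ᵀ) x⁻¹ β α) ᵀ      ≈⟨ ᵀ-cong uᵀLᵀ≈𝟎 ⟩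
    𝟎                                  ∎
    where
    open ≈ᴹ-Reasoning
    uᵀLᵀ≈𝟎 : ((u ᵀ) · L (D⁻¹ ᵀ) x⁻¹ β α) ≈ᴹ 𝟎
    uᵀLᵀ≈𝟎 = uᵀL≈𝟎 {D = D ᵀ} u β α (A·B≈I⇒Bᵀ·Aᵀ≈I D⁻¹ D D⁻¹·D≈I) x·x⁻¹≈1
               (A·B≈C⇒Bᵀ·Aᵀ≈Cᵀ D β D·β≈x⊙u) (A·B≈I⇒Bᵀ·Aᵀ≈I (α ᵀ) u αᵀ·u≈I)

lemma2p2 : ∀ {c ℓ : Level} (F : Field c ℓ) (n : ℕ) →
    let open Field F in
    let open MatrixOps commutativeRing in
    (D Dinv : Matrix n n) → (D · Dinv) ≈ᴹ I → (Dinv · D) ≈ᴹ I →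
    (λ′ λinv : Carrier) → ¬ (λ′ ≈ 0#) → λ′ * λinv ≈ 1# →
    (α β : Matrix n 1) →
    let L = (⊖ Dinv) ⊕ (λinv ⊙ (β · (α ᵀ))) in
    (  (((α ᵀ) · D) ≈ᴹ (λ′ ⊙ (𝐣 ᵀ)) × ((𝐣 ᵀ) · β) ≈ᴹ I × (L · 𝐣) ≈ᴹ 𝟎)
    ⊎ ((D · β) ≈ᴹ (λ′ ⊙ 𝐣) × ((α ᵀ) · 𝐣) ≈ᴹ I × ((𝐣 ᵀ) · L) ≈ᴹ 𝟎)
    ⊎ (((α ᵀ) · D) ≈ᴹ (λ′ ⊙ (𝐣 ᵀ)) × (D · β) ≈ᴹ (λ′ ⊙ 𝐣)
    × ((𝐣 ᵀ) · β) ≈ᴹ I × ((α ᵀ) · 𝐣) ≈ᴹ I) ) →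
    LaplacianLike L
lemma2p2 F _ D Dinv DDinv≈I DinvD≈I λ′ λinv _ λ′λinv≈1 α β = λ
  { (inj₁ (αᵀD≈λ′𝐣ᵀ , 𝐣ᵀβ≈I , L𝐣≈𝟎)) →
      L𝐣≈𝟎 , columnSums≈𝟎 αᵀD≈λ′𝐣ᵀ 𝐣ᵀβ≈I
  ; (inj₂ (inj₁ (Dβ≈λ′𝐣 , αᵀ𝐣≈I , 𝐣ᵀL≈𝟎))) →
      rowSums≈𝟎 Dβ≈λ′𝐣 αᵀ𝐣≈I , 𝐣ᵀL≈𝟎
  ; (inj₂ (inj₂ (αᵀD≈λ′𝐣ᵀ , Dβ≈λ′𝐣 , 𝐣ᵀβ≈I , αᵀ𝐣≈I))) →
      rowSums≈𝟎 Dβ≈λ′𝐣 αᵀ𝐣≈I , columnSums≈𝟎 αᵀD≈λ′𝐣ᵀ 𝐣ᵀβ≈I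
  }
  where
  open MatrixOps (Field.commutativeRing F)
  open PerturbedInverse (Field.commutativeRing F)

  columnSums≈𝟎 : ((α ᵀ) · D) ≈ᴹ (λ′ ⊙ (𝐣 ᵀ)) → ((𝐣 ᵀ) · β) ≈ᴹ I → ((𝐣 ᵀ) · L Dinv λinv α β) ≈ᴹ 𝟎
  columnSums≈𝟎 = uᵀL≈𝟎 𝐣 α β DDinv≈I λ′λinv≈1

  rowSums≈𝟎 : (D · β) ≈ᴹ (λ′ ⊙ 𝐣) → ((α ᵀ) · 𝐣) ≈ᴹ I → (L Dinv λinv α β · 𝐣) ≈ᴹ 𝟎
  rowSums≈𝟎 = Lu≈𝟎 𝐣 α β DinvD≈I λ′λinv≈1
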